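{- Let $G$ be a strongly connected ribbon digraph. The number of linear equivalence classes of divisor-and-rotor configurations $(x,\varrho)$ on $G$ with $\deg(x)=1$ equals the number of rotor-router unicycle-orbits of $G$.
   Context: A digraph here is strongly connected, may have multiple edges, and has no loops. A ribbon digraph is a digraph with, for each vertex $v$, a fixed cyclic ordering of the edges leaving $v$; $e^+$ denotes the edge after $e$. A divisor is $x\in\mathbb{Z}^{V(G)}$, with $\deg(x)=\sum_v x(v)$. A rotor configuration $\varrho$ assigns to each vertex $v$ an edge $\varrho(v)$ with tail $v$; its rotor subgraph has edge set $\{\varrho(v)\}$. A divisor-and-rotor configuration (DRC) is a pair $(x,\varrho)$. Routing at $v$ transforms $(x,\varrho)$ into $(x',\varrho')$ with $\varrho'(v)=\varrho(v)^+$, $\varrho'(u)=\varrho(u)$ for $u\ne v$, and $x'=x-\mathbf{1}_v+\mathbf{1}_{v'}$ where $v'$ is the head of $\varrho(v)^+$; it is legal if $x(v)>0$ and unconstrained if no condition is imposed. Two DRCs are linearly equivalent if one can be reached from the other by a sequence of unconstrained routings. A unicycle is a DRC $(\mathbf{1}_v,\varrho)$ whose rotor subgraph contains a unique directed cycle with $v$ on it. The rotor-router orbit of a one chip-and-rotor configuration $(\mathbf{1}_v,\varrho)$ is the set of configurations reachable from it by legal routings (at each step the chip's vertex is routed); a unicycle-orbit is the orbit of a unicycle, and the number of unicycle-orbits is the number of distinct such orbits. -}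

module Defs where

open import Data.Nat as ℕ using (ℕ; zero; suc; _%_)
open import Data.Nat.DivMod using (m%n<n)
open import Data.Fin as Fin using (Fin; toℕ; fromℕ<; _≟_)
open import Data.Integer as ℤ using (ℤ; +_; _+_; _-_)
open import Data.Bool using (if_then_else_)
open import Data.Product using (Σ; ∃; _×_)
open import Data.Sum using (_⊎_)
open import Relation.Nullary using (¬_)
open import Relation.Nullary.Decidable using (⌊_⌋)
open import Relation.Binary.PropositionalEquality using (_≡_; _≢_)

cnext : ∀ {d} → Fin d → Fin d
cnext {suc d} i = fromℕ< (m%n<n (suc (toℕ i)) (suc d))

-- The edges leaving v are indexed by
-- Fin (outdeg v), with head given by `head`; the cyclic ordering of the
-- edges leaving v is e ↦ e + 1 (mod outdeg v).  Multiple edges allowed.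
record RibbonDigraph : Set where
  field
    n       : ℕ
    outdeg  : Fin n → ℕ
    head    : (v : Fin n) → Fin (outdeg v) → Fin n
    noLoops : ∀ v e → head v e ≢ v

module _ (G : RibbonDigraph) where
  open RibbonDigraph G

  data Walk : Fin n → Fin n → Set where
    here : ∀ {u} → Walk u u
    edge : ∀ {u w} (e : Fin (outdeg u)) → Walk (head u e) w → Walk u w

  StronglyConnected : Set
  StronglyConnected = ∀ u w → Walk u w

  Divisor : Set
  Divisor = Fin n → ℤ

  Rotor : Set
  Rotor = (v : Fin n) → Fin (outdeg v)

  record DRC : Set where
    constructor drc
    field
      div : Divisor
      rot : Rotor
  open DRC public

  _≈_ : DRC → DRC → Set
  A ≈ B = (∀ u → div A u ≡ div B u) × (∀ u → rot A u ≡ rot B u)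

  ind : Fin n → Divisor
  ind v u = if ⌊ u ≟ v ⌋ then + 1 else + 0

  Route : Fin n → DRC → DRC → Set
  Route v A B =
    (∀ u → rot B u ≡ (if ⌊ u ≟ v ⌋ then cnext (rot A u) else rot A u)) ×
    (∀ u → div B u ≡ div A u - ind v u + ind (head v (cnext (rot A v))) u)

  UnconstrainedStep : DRC → DRC → Set
  UnconstrainedStep A B = ∃ λ v → Route v A B

  LegalStep : DRC → DRC → Set
  LegalStep A B = ∃ λ v → (+ 0 ℤ.< div A v) × Route v A B

  data Reach (R : DRC → DRC → Set) : DRC → DRC → Set where
    done : ∀ {A B} → A ≈ B → Reach R A B
    step : ∀ {A B C} → R A B → Reach R B C → Reach R A C

  LinEquiv : DRC → DRC → Set
  LinEquiv A B = Reach UnconstrainedStep A B ⊎ Reach UnconstrainedStep B A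

  sumFin : ∀ {m} → (Fin m → ℤ) → ℤ
  sumFin {zero} f = + 0
  sumFin {suc m} f = f Fin.zero + sumFin (λ i → f (Fin.suc i))

  deg : Divisor → ℤ
  deg x = sumFin x

  -- rotor subgraph as a functional graph: u ↦ head of ρ(u)
  rsucc : Rotor → Fin n → Fin n
  rsucc ρ u = head u (ρ u)

  iter : ℕ → (Fin n → Fin n) → Fin n → Fin n
  iter zero f u = u
  iter (suc k) f u = f (iter k f u)

  OnCycle : Rotor → Fin n → Set
  OnCycle ρ u = ∃ λ k → iter (suc k) (rsucc ρ) u ≡ u

  -- unicycle: (1_v, ρ) with the rotor subgraph containing a unique directed
  -- cycle, and v on it (every cycle vertex lies on the cycle through v)
  Unicycle : DRC → Set
  Unicycle A = ∃ λ v →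
    (∀ u → div A u ≡ ind v u) ×
    OnCycle (rot A) v ×
    (∀ u → OnCycle (rot A) u → ∃ λ j → iter j (rsucc (rot A)) v ≡ u)

  InOrbit : DRC → DRC → Set
  InOrbit U C = Reach LegalStep U C

  SameOrbit : DRC → DRC → Set
  SameOrbit U U' = ∀ C → (InOrbit U C → InOrbit U' C) × (InOrbit U' C → InOrbit U C)

  NumDeg1Classes : ℕ → Set
  NumDeg1Classes k = Σ (Fin k → DRC) λ f →
    (∀ i → deg (div (f i)) ≡ + 1) ×
    (∀ i j → LinEquiv (f i) (f j) → i ≡ j) ×
    (∀ A → deg (div A) ≡ + 1 → ∃ λ i → LinEquiv A (f i))

  NumUnicycleOrbits : ℕ → Set
  NumUnicycleOrbits m = Σ (Fin m → DRC) λ g →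
    (∀ i → Unicycle (g i)) ×
    (∀ i j → SameOrbit (g i) (g j) → i ≡ j) ×
    (∀ U → Unicycle U → ∃ λ i → SameOrbit U (g i))

module Submission where

-- A one-chip configuration (1_v, ρ) is a state of the rotor walk; its legal
-- routings are exactly the steps of the walk, so its orbit is the walk.  The
-- proof has three ingredients.
--   * Walks on a strongly connected digraph visit every vertex and then their
--     state is a unicycle; unicycle states are preserved and the walk step is
--     injective on them, so a walk from a unicycle is periodic (a cycle of states).
--   * Unconstrained routing only depends on how often each vertex is routed
--     (routeBy); if routing a from (1_v, ρ) gives a unicycle, the rotor walk
--     itself reaches it (least action principle).  Hence two unicycles are
--     linearly equivalent exactly when they lie in the same orbit.
--   * By moving chips from vertices that have chips to vertices in debt, every
--     degree-1 configuration is linearly equivalent to a unicycle.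
-- Choosing one unicycle per orbit (a transversal of a decidable equivalence
-- relation on the finite set of states) then counts both kinds of classes.

open import Defs
open import Data.Nat as ℕ using (ℕ; zero; suc; _≤_; _<_; z≤n; s≤s; _∸_; _%_)
import Data.Nat.Properties as ℕP
open import Data.Nat.DivMod using (%-distribˡ-+; m%n%n≡m%n; m<n⇒m%n≡m; [m+n]%n≡m%n)
open import Data.Fin as Fin using (Fin; toℕ)
import Data.Fin.Properties as FinP
open import Data.Integer as ℤ using (ℤ; +_; -[1+_]; ∣_∣)
import Data.Integer.Properties as ℤP
open import Data.Integer.Tactic.RingSolver using (solve-∀)
open import Data.Bool using (if_then_else_)
open import Data.Product using (Σ; _×_; ∃; ∃₂; _,_; proj₁; proj₂)
open import Data.Sum using (inj₁; inj₂)
open import Data.Empty using (⊥; ⊥-elim)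
open import Level using (0ℓ)
open import Relation.Nullary using (¬_; Dec; yes; no; ¬?; _×-dec_; _→-dec_)
open import Relation.Nullary.Decidable using (⌊_⌋)
open import Relation.Binary.Core using (Rel)
open import Relation.Binary.Structures using (IsDecEquivalence)
open import Relation.Binary.Definitions using (tri<; tri≈; tri>)
open import Relation.Binary.PropositionalEquality

module CyclicOrder where

  cnext^ : ∀ {d} → ℕ → Fin d → Fin d
  cnext^ zero e = e
  cnext^ (suc j) e = cnext (cnext^ j e)

  cnext^-suc : ∀ {d} j (e : Fin d) → cnext^ j (cnext e) ≡ cnext^ (suc j) e
  cnext^-suc zero e = refl
  cnext^-suc (suc j) e = cong cnext (cnext^-suc j e)

  toℕ-cnext^ : ∀ {d} j (e : Fin (suc d)) → toℕ (cnext^ j e) ≡ (toℕ e ℕ.+ j) % suc d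
  toℕ-cnext^ {d} zero e = begin
    toℕ e                        ≡⟨ m<n⇒m%n≡m (FinP.toℕ<n e) ⟨
    toℕ e % suc d                ≡⟨ cong (_% suc d) (ℕP.+-identityʳ (toℕ e)) ⟨
    (toℕ e ℕ.+ 0) % suc d        ∎
    where open ≡-Reasoning
  toℕ-cnext^ {d} (suc j) e = begin
    toℕ (cnext (cnext^ j e))                  ≡⟨ FinP.toℕ-fromℕ< _ ⟩
    suc (toℕ (cnext^ j e)) % D                ≡⟨ cong (λ x → suc x % D) (toℕ-cnext^ j e) ⟩
    (1 ℕ.+ (toℕ e ℕ.+ j) % D) % D             ≡⟨ %-distribˡ-+ 1 ((toℕ e ℕ.+ j) % D) D ⟩
    (1 % D ℕ.+ (toℕ e ℕ.+ j) % D % D) % D     ≡⟨ cong (λ x → (1 % D ℕ.+ x) % D) (m%n%n≡m%n (toℕ e ℕ.+ j) D) ⟩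
    (1 % D ℕ.+ (toℕ e ℕ.+ j) % D) % D         ≡⟨ %-distribˡ-+ 1 _ D ⟨
    suc (toℕ e ℕ.+ j) % D                     ≡⟨ cong (_% D) (ℕP.+-suc (toℕ e) j) ⟨
    (toℕ e ℕ.+ suc j) % D                     ∎
    where
    open ≡-Reasoning
    D = suc d

  cnext^-surjective : ∀ {d} (e e' : Fin d) → ∃ λ j → cnext^ j e ≡ e'
  cnext^-surjective {suc d} e e' = j , FinP.toℕ-injective (begin
    toℕ (cnext^ j e)                          ≡⟨ toℕ-cnext^ j e ⟩
    (toℕ e ℕ.+ ((D ∸ toℕ e) ℕ.+ toℕ e')) % D  ≡⟨ cong (_% D) (ℕP.+-assoc (toℕ e) _ _) ⟨
    (toℕ e ℕ.+ (D ∸ toℕ e) ℕ.+ toℕ e') % D    ≡⟨ cong (λ x → (x ℕ.+ toℕ e') % D) (ℕP.m+[n∸m]≡n (ℕP.<⇒≤ (FinP.toℕ<n e))) ⟩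
    (D ℕ.+ toℕ e') % D                        ≡⟨ cong (_% D) (ℕP.+-comm D (toℕ e')) ⟩
    (toℕ e' ℕ.+ D) % D                        ≡⟨ [m+n]%n≡m%n (toℕ e') D ⟩
    toℕ e' % D                                ≡⟨ m<n⇒m%n≡m (FinP.toℕ<n e') ⟩
    toℕ e'                                    ∎)
    where
    open ≡-Reasoning
    D = suc d
    j = (D ∸ toℕ e) ℕ.+ toℕ e'

  -- going around all suc d edges returns to the start, hence the successor is injective
  cnext^-period : ∀ {d} (e : Fin (suc d)) → cnext^ (suc d) e ≡ e
  cnext^-period {d} e = FinP.toℕ-injective (begin
    toℕ (cnext^ (suc d) e)        ≡⟨ toℕ-cnext^ (suc d) e ⟩
    (toℕ e ℕ.+ suc d) % suc d     ≡⟨ [m+n]%n≡m%n (toℕ e) (suc d) ⟩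
    toℕ e % suc d                 ≡⟨ m<n⇒m%n≡m (FinP.toℕ<n e) ⟩
    toℕ e                         ∎)
    where open ≡-Reasoning

  cnext-injective : ∀ {d} {e e' : Fin d} → cnext e ≡ cnext e' → e ≡ e'
  cnext-injective {suc d} {e} {e'} eq = begin
    e                     ≡⟨ cnext^-period e ⟨
    cnext^ (suc d) e      ≡⟨ cnext^-suc d e ⟨
    cnext^ d (cnext e)    ≡⟨ cong (cnext^ d) eq ⟩
    cnext^ d (cnext e')   ≡⟨ cnext^-suc d e' ⟩
    cnext^ (suc d) e'     ≡⟨ cnext^-period e' ⟩
    e'                    ∎
    where open ≡-Reasoning

module NatSums where

  sumN : ∀ {k} → (Fin k → ℕ) → ℕ
  sumN {zero} f = 0
  sumN {suc k} f = f Fin.zero ℕ.+ sumN (λ i → f (Fin.suc i))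

  sumN-cong : ∀ {k} (f g : Fin k → ℕ) → (∀ i → f i ≡ g i) → sumN f ≡ sumN g
  sumN-cong {zero} f g eq = refl
  sumN-cong {suc k} f g eq = cong₂ ℕ._+_ (eq Fin.zero) (sumN-cong _ _ (λ i → eq (Fin.suc i)))

  sumN-zero : ∀ {k} → sumN {k} (λ _ → 0) ≡ 0
  sumN-zero {zero} = refl
  sumN-zero {suc k} = sumN-zero {k}

  sumN-mono : ∀ {k} (f g : Fin k → ℕ) → (∀ i → g i ≤ f i) → sumN g ≤ sumN f
  sumN-mono {zero} f g le = z≤n
  sumN-mono {suc k} f g le =
    ℕP.+-mono-≤ (le Fin.zero) (sumN-mono (λ i → f (Fin.suc i)) (λ i → g (Fin.suc i)) (λ i → le (Fin.suc i)))

  term≤sumN : ∀ {k} (f : Fin k → ℕ) (i : Fin k) → f i ≤ sumN f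
  term≤sumN {suc k} f Fin.zero = ℕP.m≤m+n _ _
  term≤sumN {suc k} f (Fin.suc i) = ℕP.≤-trans (term≤sumN (λ j → f (Fin.suc j)) i) (ℕP.m≤n+m _ (f Fin.zero))

  sumN-raise : ∀ {k} (f g : Fin k → ℕ) (i : Fin k) (m : ℕ) →
    (∀ j → j ≢ i → f j ≡ g j) → f i ≡ g i ℕ.+ m → sumN f ≡ sumN g ℕ.+ m
  sumN-raise {suc k} f g Fin.zero m others at-i = begin
    f Fin.zero ℕ.+ sumN f′                ≡⟨ cong₂ ℕ._+_ at-i (sumN-cong f′ g′ (λ j → others (Fin.suc j) (λ ()))) ⟩
    g Fin.zero ℕ.+ m ℕ.+ sumN g′          ≡⟨ ℕP.+-assoc (g Fin.zero) m _ ⟩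
    g Fin.zero ℕ.+ (m ℕ.+ sumN g′)        ≡⟨ cong (g Fin.zero ℕ.+_) (ℕP.+-comm m _) ⟩
    g Fin.zero ℕ.+ (sumN g′ ℕ.+ m)        ≡⟨ ℕP.+-assoc (g Fin.zero) _ m ⟨
    sumN g ℕ.+ m                          ∎
    where
    open ≡-Reasoning
    f′ g′ : Fin k → ℕ
    f′ j = f (Fin.suc j)
    g′ j = g (Fin.suc j)
  sumN-raise {suc k} f g (Fin.suc i) m others at-i = begin
    f Fin.zero ℕ.+ sumN (λ j → f (Fin.suc j))
      ≡⟨ cong₂ ℕ._+_ (others Fin.zero (λ ()))
           (sumN-raise _ _ i m (λ j j≢i → others (Fin.suc j) (λ eq → j≢i (FinP.suc-injective eq))) at-i) ⟩
    g Fin.zero ℕ.+ (sumN (λ j → g (Fin.suc j)) ℕ.+ m)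
      ≡⟨ ℕP.+-assoc (g Fin.zero) _ m ⟨
    sumN g ℕ.+ m ∎
    where open ≡-Reasoning

  sumN-mono-gap : ∀ {k} (f g : Fin k → ℕ) (i : Fin k) (m : ℕ) →
    (∀ j → g j ≤ f j) → g i ℕ.+ m ≤ f i → sumN g ℕ.+ m ≤ sumN f
  sumN-mono-gap {suc k} f g Fin.zero m le gap = begin
    g Fin.zero ℕ.+ sumN g′ ℕ.+ m      ≡⟨ ℕP.+-assoc (g Fin.zero) _ m ⟩
    g Fin.zero ℕ.+ (sumN g′ ℕ.+ m)    ≡⟨ cong (g Fin.zero ℕ.+_) (ℕP.+-comm _ m) ⟩
    g Fin.zero ℕ.+ (m ℕ.+ sumN g′)    ≡⟨ ℕP.+-assoc (g Fin.zero) m _ ⟨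
    g Fin.zero ℕ.+ m ℕ.+ sumN g′      ≤⟨ ℕP.+-mono-≤ gap (sumN-mono f′ g′ (λ j → le (Fin.suc j))) ⟩
    sumN f                            ∎
    where
    open ℕP.≤-Reasoning
    f′ g′ : Fin k → ℕ
    f′ j = f (Fin.suc j)
    g′ j = g (Fin.suc j)
  sumN-mono-gap {suc k} f g (Fin.suc i) m le gap = begin
    g Fin.zero ℕ.+ sumN g′ ℕ.+ m      ≡⟨ ℕP.+-assoc (g Fin.zero) _ m ⟩
    g Fin.zero ℕ.+ (sumN g′ ℕ.+ m)    ≤⟨ ℕP.+-mono-≤ (le Fin.zero) (sumN-mono-gap f′ g′ i m (λ j → le (Fin.suc j)) gap) ⟩
    sumN f                            ∎
    where
    open ℕP.≤-Reasoning
    f′ g′ : Fin k → ℕ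
    f′ j = f (Fin.suc j)
    g′ j = g (Fin.suc j)

module Transversal where

  enumerate : ∀ {k} (P : Fin k → Set) → (∀ x → Dec (P x)) →
    Σ ℕ λ m → Σ (Fin m → Fin k) λ e →
      (∀ i → P (e i)) × (∀ i j → e i ≡ e j → i ≡ j) × (∀ x → P x → ∃ λ i → e i ≡ x)
  enumerate {zero} P P? = 0 , (λ ()) , (λ ()) , (λ ()) , (λ ())
  enumerate {suc k} P P? with enumerate (λ x → P (Fin.suc x)) (λ x → P? (Fin.suc x)) | P? Fin.zero
  ... | m , e , inP , inj , onto | no ¬P0 = m , (λ i → Fin.suc (e i)) , inP ,
        (λ i j eq → inj i j (FinP.suc-injective eq)) , onto′
    where
    onto′ : ∀ x → P x → ∃ λ i → Fin.suc (e i) ≡ x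
    onto′ Fin.zero p = ⊥-elim (¬P0 p)
    onto′ (Fin.suc x) p with onto x p
    ... | i , eq = i , cong Fin.suc eq
  ... | m , e , inP , inj , onto | yes P0 = suc m , e′ , inP′ , inj′ , onto′
    where
    e′ : Fin (suc m) → Fin (suc k)
    e′ Fin.zero = Fin.zero
    e′ (Fin.suc i) = Fin.suc (e i)
    inP′ : ∀ i → P (e′ i)
    inP′ Fin.zero = P0
    inP′ (Fin.suc i) = inP i
    inj′ : ∀ i j → e′ i ≡ e′ j → i ≡ j
    inj′ Fin.zero Fin.zero _ = refl
    inj′ (Fin.suc i) (Fin.suc j) eq = cong Fin.suc (inj i j (FinP.suc-injective eq))
    onto′ : ∀ x → P x → ∃ λ i → e′ i ≡ x
    onto′ Fin.zero _ = Fin.zero , refl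
    onto′ (Fin.suc x) p with onto x p
    ... | i , eq = Fin.suc i , cong Fin.suc eq

  module _ {k} {_~_ : Rel (Fin k) 0ℓ} (isDecEquiv : IsDecEquivalence _~_) where
    open IsDecEquivalence isDecEquiv using () renaming (_≟_ to _~?_; refl to ~-refl; sym to ~-sym; trans to ~-trans)

    Least : Fin k → Set
    Least x = ∀ y → y Fin.< x → ¬ y ~ x

    least? : ∀ x → Dec (Least x)
    least? x = FinP.all? (λ y → (y FinP.<? x) →-dec ¬? (y ~? x))

    least-unique : ∀ {x y} → Least x → Least y → x ~ y → x ≡ y
    least-unique {x} {y} lx ly x~y with FinP.<-cmp x y
    ... | tri< x<y _ _ = ⊥-elim (ly x x<y x~y)
    ... | tri≈ _ x≡y _ = x≡y
    ... | tri> _ _ y<x = ⊥-elim (lx y y<x (~-sym x~y))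

    least-exists : ∀ x → ∃ λ y → Least y × y ~ x
    least-exists x = descend (toℕ x) x ℕP.≤-refl
      where
      descend : ∀ b x → toℕ x ≤ b → ∃ λ y → Least y × y ~ x
      descend b x x≤b with least? x
      ... | yes lx = x , lx , ~-refl
      descend zero x x≤0 | no ¬lx = ⊥-elim (¬lx (λ y y<x → ⊥-elim (ℕP.n≮0 (ℕP.<-≤-trans y<x x≤0))))
      descend (suc b) x x≤b | no ¬lx with FinP.any? (λ y → (y FinP.<? x) ×-dec (y ~? x))
      ... | no none = ⊥-elim (¬lx (λ y y<x y~x → none (y , y<x , y~x)))
      ... | yes (y , y<x , y~x) with descend b y (ℕP.≤-pred (ℕP.≤-trans y<x x≤b))
      ...   | z , lz , z~y = z , lz , ~-trans z~y y~x

    transversal : Σ ℕ λ m → Σ (Fin m → Fin k) λ e →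
      (∀ i j → e i ~ e j → i ≡ j) × (∀ x → ∃ λ i → e i ~ x)
    transversal with enumerate Least least?
    ... | m , e , least , inj , onto = m , e ,
          (λ i j ei~ej → inj i j (least-unique (least i) (least j) ei~ej)) ,
          λ x → let (y , ly , y~x) = least-exists x
                    (i , ei≡y)     = onto y ly
                in i , subst (_~ x) (sym ei≡y) y~x

module Configurations (G : RibbonDigraph) where
  open RibbonDigraph G

  _≋_ : DRC G → DRC G → Set
  _≋_ = _≈_ G

  ≋-refl : ∀ {A} → A ≋ A
  ≋-refl = (λ u → refl) , (λ u → refl)

  ≋-sym : ∀ {A B} → A ≋ B → B ≋ A
  ≋-sym (d , r) = (λ u → sym (d u)) , (λ u → sym (r u))

  ≋-trans : ∀ {A B C} → A ≋ B → B ≋ C → A ≋ C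
  ≋-trans (d , r) (d′ , r′) = (λ u → trans (d u) (d′ u)) , (λ u → trans (r u) (r′ u))

  route-respˡ : ∀ {v A A′ B} → A ≋ A′ → Route G v A B → Route G v A′ B
  route-respˡ {v} (d , r) (routed-rot , routed-div) =
    (λ u → trans (routed-rot u) (cong₂ (λ a b → if ⌊ u Fin.≟ v ⌋ then a else b) (cong cnext (r u)) (r u))) ,
    (λ u → trans (routed-div u) (cong₂ (λ a ρv → a ℤ.- ind G v u ℤ.+ ind G (head v (cnext ρv)) u) (d u) (r v)))

  route-functional : ∀ {v} A {B B′} → Route G v A B → Route G v A B′ → B ≋ B′
  route-functional A (rot-B , div-B) (rot-B′ , div-B′) =
    (λ u → trans (div-B u) (sym (div-B′ u))) , (λ u → trans (rot-B u) (sym (rot-B′ u)))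

  legal-respˡ : ∀ {A A′ B} → A ≋ A′ → LegalStep G A B → LegalStep G A′ B
  legal-respˡ eq (v , positive , r) = v , subst (+ 0 ℤ.<_) (proj₁ eq v) positive , route-respˡ eq r

  unconstrained-respˡ : ∀ {A A′ B} → A ≋ A′ → UnconstrainedStep G A B → UnconstrainedStep G A′ B
  unconstrained-respˡ eq (v , r) = v , route-respˡ eq r

  module _ {R : DRC G → DRC G → Set} (R-respˡ : ∀ {A A′ B} → A ≋ A′ → R A B → R A′ B) where

    reach-respˡ : ∀ {A A′ C} → A ≋ A′ → Reach G R A C → Reach G R A′ C
    reach-respˡ eq (done A≋C) = done (≋-trans (≋-sym eq) A≋C)
    reach-respˡ eq (step r rs) = step (R-respˡ eq r) rs

    reach-trans : ∀ {A B C} → Reach G R A B → Reach G R B C → Reach G R A C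
    reach-trans (done A≋B) rs = reach-respˡ (≋-sym A≋B) rs
    reach-trans (step r rs) rs′ = step r (reach-trans rs rs′)

  legal⇒unconstrained : ∀ {A B} → Reach G (LegalStep G) A B → Reach G (UnconstrainedStep G) A B
  legal⇒unconstrained (done eq) = done eq
  legal⇒unconstrained (step (v , _ , r) rs) = step (v , r) (legal⇒unconstrained rs)

  ind-self : ∀ v → ind G v v ≡ + 1
  ind-self v with v Fin.≟ v
  ... | yes _ = refl
  ... | no v≢v = ⊥-elim (v≢v refl)

  ind-other : ∀ v u → u ≢ v → ind G v u ≡ + 0
  ind-other v u u≢v with u Fin.≟ v
  ... | yes u≡v = ⊥-elim (u≢v u≡v)
  ... | no _ = refl

-- A one-chip configuration (1_v, ρ) is a
-- State; legal routing moves the chip deterministically, so the rotor-router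
-- orbit of (1_v, ρ) is the set of states along the walk.
module RotorWalk (G : RibbonDigraph) where
  open RibbonDigraph G
  open Configurations G

  record State : Set where
    constructor state
    field
      chip   : Fin n
      rotors : Rotor G
  open State public

  turn : Rotor G → Fin n → Rotor G
  turn ρ v u = if ⌊ u Fin.≟ v ⌋ then cnext (ρ u) else ρ u

  turn-self : ∀ ρ v → turn ρ v v ≡ cnext (ρ v)
  turn-self ρ v with v Fin.≟ v
  ... | yes _ = refl
  ... | no v≢v = ⊥-elim (v≢v refl)

  turn-other : ∀ ρ v u → u ≢ v → turn ρ v u ≡ ρ u
  turn-other ρ v u u≢v with u Fin.≟ v
  ... | yes u≡v = ⊥-elim (u≢v u≡v)
  ... | no _ = refl

  move : State → State
  move (state v ρ) = state (head v (cnext (ρ v))) (turn ρ v)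

  run : ℕ → State → State
  run zero s = s
  run (suc k) s = move (run k s)

  run-+ : ∀ k m s → run (k ℕ.+ m) s ≡ run k (run m s)
  run-+ zero m s = refl
  run-+ (suc k) m s = cong move (run-+ k m s)

  run-suc : ∀ k s → run k (move s) ≡ run (suc k) s
  run-suc k s = trans (sym (run-+ k 1 s)) (cong (λ t → run t s) (ℕP.+-comm k 1))

  _≃_ : State → State → Set
  s ≃ t = chip s ≡ chip t × (∀ u → rotors s u ≡ rotors t u)

  ≃-refl : ∀ {s} → s ≃ s
  ≃-refl = refl , (λ u → refl)

  ≃-sym : ∀ {s t} → s ≃ t → t ≃ s
  ≃-sym (c , r) = sym c , (λ u → sym (r u))

  ≃-trans : ∀ {s t t′} → s ≃ t → t ≃ t′ → s ≃ t′
  ≃-trans (c , r) (c′ , r′) = trans c c′ , (λ u → trans (r u) (r′ u))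

  ≃-reflexive : ∀ {s t} → s ≡ t → s ≃ t
  ≃-reflexive refl = ≃-refl

  move-cong : ∀ {s t} → s ≃ t → move s ≃ move t
  move-cong {state v ρ} {state .v ρ′} (refl , r) = cong (λ e → head v (cnext e)) (r v) , turn-cong
    where
    turn-cong : ∀ u → turn ρ v u ≡ turn ρ′ v u
    turn-cong u with u Fin.≟ v
    ... | yes _ = cong cnext (r u)
    ... | no _ = r u

  run-cong : ∀ k {s t} → s ≃ t → run k s ≃ run k t
  run-cong zero eq = eq
  run-cong (suc k) eq = move-cong (run-cong k eq)

  _≟ₛ_ : ∀ s t → Dec (s ≃ t)
  state v ρ ≟ₛ state w σ with v Fin.≟ w | FinP.all? (λ u → ρ u Fin.≟ σ u)
  ... | yes c | yes r = yes (c , r)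
  ... | no ¬c | _ = no (λ eq → ¬c (proj₁ eq))
  ... | _ | no ¬r = no (λ eq → ¬r (proj₂ eq))

  config : State → DRC G
  config s = drc (ind G (chip s)) (rotors s)

  config-cong : ∀ {s t} → s ≃ t → config s ≋ config t
  config-cong (c , r) = (λ u → cong (λ v → ind G v u) c) , r

  config-injective : ∀ {s t} → config s ≋ config t → s ≃ t
  config-injective {state v ρ} {state w σ} (d , r) with v Fin.≟ w
  ... | yes v≡w = v≡w , r
  ... | no v≢w with trans (sym (ind-self v)) (trans (d v) (ind-other w v v≢w))
  ...   | ()

  route-config : ∀ s → Route G (chip s) (config s) (config (move s))
  route-config (state v ρ) = (λ u → refl) , (λ u → cancel (ind G v u) _)
    where
    cancel : ∀ (a b : ℤ) → b ≡ a ℤ.- a ℤ.+ b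
    cancel = solve-∀

  legal-config : ∀ s → LegalStep G (config s) (config (move s))
  legal-config s = chip s , subst (+ 0 ℤ.<_) (sym (ind-self (chip s))) (ℤ.+<+ (s≤s z≤n)) , route-config s

  legal-determined : ∀ s B → LegalStep G (config s) B → B ≋ config (move s)
  legal-determined s B (v , positive , r) with v Fin.≟ chip s
  ... | yes refl = route-functional (config s) r (route-config s)
  ... | no _ with positive
  ...   | ℤ.+<+ ()

  run-legal : ∀ k s → Reach G (LegalStep G) (config s) (config (run k s))
  run-legal zero s = done ≋-refl
  run-legal (suc k) s = reach-trans legal-respˡ (run-legal k s) (step (legal-config (run k s)) (done ≋-refl))

  orbit⇒run : ∀ {A C} → Reach G (LegalStep G) A C → ∀ s → A ≋ config s → ∃ λ k → config (run k s) ≋ C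
  orbit⇒run (done A≋C) s eq = 0 , ≋-trans (≋-sym eq) A≋C
  orbit⇒run (step {B = B} r rs) s eq with orbit⇒run rs (move s) (legal-determined s B (legal-respˡ eq r))
  ... | k , reached = suc k , ≋-trans (config-cong (≃-reflexive (sym (run-suc k s)))) reached

module FunctionalGraph (G : RibbonDigraph) where
  open RibbonDigraph G

  iter-suc : ∀ k (f : Fin n → Fin n) u → iter G k f (f u) ≡ iter G (suc k) f u
  iter-suc zero f u = refl
  iter-suc (suc k) f u = cong f (iter-suc k f u)

  iter-+ : ∀ j k (f : Fin n → Fin n) u → iter G (j ℕ.+ k) f u ≡ iter G j f (iter G k f u)
  iter-+ zero k f u = refl
  iter-+ (suc j) k f u = cong f (iter-+ j k f u)

  iter-cong : ∀ k {f g : Fin n → Fin n} → (∀ x → f x ≡ g x) → ∀ u → iter G k f u ≡ iter G k g u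
  iter-cong zero f≗g u = refl
  iter-cong (suc k) {f} {g} f≗g u = trans (cong f (iter-cong k f≗g u)) (f≗g _)

  iter-cycle : ∀ L (f : Fin n → Fin n) c → iter G L f c ≡ c → ∀ m → iter G (m ℕ.* L) f c ≡ c
  iter-cycle L f c cyc zero = refl
  iter-cycle L f c cyc (suc m) = trans (iter-+ L (m ℕ.* L) f c) (trans (cong (iter G L f) (iter-cycle L f c cyc m)) cyc)

  cycle-return : ∀ f c w k j → iter G (suc k) f c ≡ c → iter G j f c ≡ w → ∃ λ t → iter G t f w ≡ c
  cycle-return f c w k j cyc c↝w = j ℕ.* k , (begin
    iter G (j ℕ.* k) f w                  ≡⟨ cong (iter G (j ℕ.* k) f) c↝w ⟨
    iter G (j ℕ.* k) f (iter G j f c)     ≡⟨ iter-+ (j ℕ.* k) j f c ⟨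
    iter G (j ℕ.* k ℕ.+ j) f c            ≡⟨ cong (λ t → iter G t f c) (trans (ℕP.+-comm (j ℕ.* k) j) (sym (ℕP.*-suc j k))) ⟩
    iter G (j ℕ.* suc k) f c              ≡⟨ iter-cycle (suc k) f c cyc j ⟩
    c                                     ∎)
    where open ≡-Reasoning

  -- every vertex reaches a cycle (pigeonhole on its first n+1 iterates)
  reaches-cycle : ∀ f u → ∃ λ c → (∃ λ k → iter G (suc k) f c ≡ c) × (∃ λ i → iter G i f u ≡ c)
  reaches-cycle f u with FinP.pigeonhole (ℕP.n<1+n n) (λ (i : Fin (suc n)) → iter G (toℕ i) f u)
  ... | i , j , i<j , same = iter G (toℕ i) f u , (toℕ j ∸ suc (toℕ i) , cyc) , (toℕ i , refl)
    where
    open ≡-Reasoning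
    gap : suc (toℕ j ∸ suc (toℕ i)) ℕ.+ toℕ i ≡ toℕ j
    gap = trans (cong (ℕ._+ toℕ i) (sym (ℕP.+-∸-assoc 1 i<j))) (ℕP.m∸n+n≡m (ℕP.<⇒≤ i<j))
    cyc : iter G (suc (toℕ j ∸ suc (toℕ i))) f (iter G (toℕ i) f u) ≡ iter G (toℕ i) f u
    cyc = begin
      iter G (suc (toℕ j ∸ suc (toℕ i))) f (iter G (toℕ i) f u) ≡⟨ iter-+ (suc (toℕ j ∸ suc (toℕ i))) (toℕ i) f u ⟨
      iter G (suc (toℕ j ∸ suc (toℕ i)) ℕ.+ toℕ i) f u          ≡⟨ cong (λ t → iter G t f u) gap ⟩
      iter G (toℕ j) f u                                         ≡⟨ same ⟨
      iter G (toℕ i) f u                                         ∎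

  reach-agree : ∀ (f g : Fin n → Fin n) w → (∀ x → x ≢ w → g x ≡ f x) →
    ∀ j u → iter G j f u ≡ w → ∃ λ j′ → iter G j′ g u ≡ w
  reach-agree f g w agree j u hit with u Fin.≟ w
  ... | yes u≡w = 0 , u≡w
  reach-agree f g w agree zero u hit | no u≢w = ⊥-elim (u≢w hit)
  reach-agree f g w agree (suc j) u hit | no u≢w with reach-agree f g w agree j (f u) (trans (iter-suc j f u) hit)
  ... | j′ , hit′ = suc j′ , trans (sym (iter-suc j′ g u)) (subst (λ x → iter G j′ g x ≡ w) (sym (agree u u≢w)) hit′)

  exit : ∀ (P : Fin n → Set) → (∀ v → Dec (P v)) → ∀ f j u → P u → ¬ P (iter G j f u) → ∃ λ z → P z × ¬ P (f z)
  exit P P? f zero u Pu ¬Pend = ⊥-elim (¬Pend Pu)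
  exit P P? f (suc j) u Pu ¬Pend with P? (f u)
  ... | yes Pfu = exit P P? f j (f u) Pfu (λ Pend → ¬Pend (subst P (iter-suc j f u) Pend))
  ... | no ¬Pfu = u , Pu , ¬Pfu

  unique-predecessor : ∀ f q p₁ p₂ t₁ t₂ → iter G t₁ f q ≡ p₁ → f p₁ ≡ q → iter G t₂ f q ≡ p₂ → f p₂ ≡ q → p₁ ≡ p₂
  unique-predecessor f q p₁ p₂ t₁ t₂ q↝p₁ p₁→q q↝p₂ p₂→q = begin
    p₁                              ≡⟨ around t₂ t₁ p₁ q↝p₁ p₁→q ⟨
    iter G (t₁ ℕ.+ t₂ ℕ.* suc t₁) f q ≡⟨ cong (λ t → iter G t f q) same-length ⟩
    iter G (t₂ ℕ.+ t₁ ℕ.* suc t₂) f q ≡⟨ around t₁ t₂ p₂ q↝p₂ p₂→q ⟩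
    p₂                              ∎
    where
    open ≡-Reasoning
    -- q lies on a cycle of length suc b, so going around it a times changes nothing
    around : ∀ a b p → iter G b f q ≡ p → f p ≡ q → iter G (b ℕ.+ a ℕ.* suc b) f q ≡ p
    around a b p q↝p p→q =
      trans (iter-+ b (a ℕ.* suc b) f q) (trans (cong (iter G b f) (iter-cycle (suc b) f q (trans (cong f q↝p) p→q) a)) q↝p)
    same-length : t₁ ℕ.+ t₂ ℕ.* suc t₁ ≡ t₂ ℕ.+ t₁ ℕ.* suc t₂
    same-length = ℕP.suc-injective (ℕP.*-comm (suc t₂) (suc t₁))

-- Unicycles as states: (1_v, ρ) is a unicycle exactly when every rotor path
-- leads to v.  This property is preserved by the walk, and on unicycles the
-- walk step is injective.
module Unicycles (G : RibbonDigraph) where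
  open RibbonDigraph G
  open Configurations G
  open RotorWalk G
  open FunctionalGraph G
  open CyclicOrder using (cnext-injective)

  Funnel : Rotor G → Fin n → Set
  Funnel ρ w = ∀ u → ∃ λ j → iter G j (rsucc G ρ) u ≡ w

  IsUnicycle : State → Set
  IsUnicycle s = Funnel (rotors s) (chip s)

  funnel⇒on-cycle : ∀ ρ w → Funnel ρ w → OnCycle G ρ w
  funnel⇒on-cycle ρ w funnel with funnel (rsucc G ρ w)
  ... | j , hit = j , trans (sym (iter-suc j _ w)) hit

  funnel⇒unique-cycle : ∀ ρ w → Funnel ρ w → ∀ u → OnCycle G ρ u → ∃ λ j → iter G j (rsucc G ρ) w ≡ u
  funnel⇒unique-cycle ρ w funnel u (k , cyc) with funnel u
  ... | j , u↝w = cycle-return (rsucc G ρ) u w k j cyc u↝w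

  unique-cycle⇒funnel : ∀ ρ w → OnCycle G ρ w → (∀ u → OnCycle G ρ u → ∃ λ j → iter G j (rsucc G ρ) w ≡ u) → Funnel ρ w
  unique-cycle⇒funnel ρ w (k , w-cyc) unique u with reaches-cycle (rsucc G ρ) u
  ... | c , c-cyc , (i , u↝c) with unique c c-cyc
  ... | j , w↝c with cycle-return (rsucc G ρ) w c k j w-cyc w↝c
  ... | t , c↝w = t ℕ.+ i , trans (iter-+ t i _ u) (trans (cong (iter G t _) u↝c) c↝w)

  unicycle-config : ∀ s → IsUnicycle s → Unicycle G (config s)
  unicycle-config s funnel =
    chip s , (λ u → refl) , funnel⇒on-cycle (rotors s) (chip s) funnel , funnel⇒unique-cycle (rotors s) (chip s) funnel

  unicycle-state : ∀ A → Unicycle G A → ∃ λ v → (A ≋ config (state v (rot A))) × IsUnicycle (state v (rot A))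
  unicycle-state A (v , div≡ , on-cycle , unique) = v , (div≡ , λ u → refl) , unique-cycle⇒funnel (rot A) v on-cycle unique

  rsucc-turn-self : ∀ ρ v → rsucc G (turn ρ v) v ≡ head v (cnext (ρ v))
  rsucc-turn-self ρ v = cong (head v) (turn-self ρ v)

  reach-after-turn : ∀ ρ v u j → iter G j (rsucc G ρ) u ≡ v → ∃ λ j′ → iter G j′ (rsucc G (turn ρ v)) u ≡ v
  reach-after-turn ρ v u j = reach-agree (rsucc G ρ) (rsucc G (turn ρ v)) v (λ x x≢v → cong (head x) (turn-other ρ v x x≢v)) j u

  -- a vertex that led to the chip now leads, through the chip's old position, to its new one
  reach-chip-after-move : ∀ s u j → iter G j (rsucc G (rotors s)) u ≡ chip s →
    ∃ λ j′ → iter G j′ (rsucc G (rotors (move s))) u ≡ chip (move s)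
  reach-chip-after-move (state v ρ) u j u↝v with reach-after-turn ρ v u j u↝v
  ... | j′ , u↝v′ = suc j′ , trans (cong (rsucc G (turn ρ v)) u↝v′) (rsucc-turn-self ρ v)

  move-unicycle : ∀ s → IsUnicycle s → IsUnicycle (move s)
  move-unicycle s funnel u = reach-chip-after-move s u (proj₁ (funnel u)) (proj₂ (funnel u))

  run-unicycle : ∀ k s → IsUnicycle s → IsUnicycle (run k s)
  run-unicycle zero s funnel = funnel
  run-unicycle (suc k) s funnel = move-unicycle _ (run-unicycle k s funnel)

  -- the walk step is injective on unicycles: the previous chip position is the
  -- unique cycle predecessor of the current one, and then the rotors are determined
  move-injective : ∀ s₁ s₂ → IsUnicycle s₁ → IsUnicycle s₂ → move s₁ ≃ move s₂ → s₁ ≃ s₂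
  move-injective (state v₁ ρ₁) (state v₂ ρ₂) uni₁ uni₂ (same-chip , same-rotors)
    with reach-after-turn ρ₁ v₁ q (proj₁ (uni₁ q)) (proj₂ (uni₁ q))
       | reach-after-turn ρ₂ v₂ q₂ (proj₁ (uni₂ q₂)) (proj₂ (uni₂ q₂))
    where
    q = head v₁ (cnext (ρ₁ v₁))
    q₂ = head v₂ (cnext (ρ₂ v₂))
  ... | t₁ , q↝v₁ | t₂ , q₂↝v₂ = v₁≡v₂ , same-old-rotors
    where
    f = rsucc G (turn ρ₁ v₁)
    f₂≗f : ∀ x → rsucc G (turn ρ₂ v₂) x ≡ f x
    f₂≗f x = cong (head x) (sym (same-rotors x))
    q↝v₂ : iter G t₂ f (head v₁ (cnext (ρ₁ v₁))) ≡ v₂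
    q↝v₂ = trans (cong (iter G t₂ f) same-chip) (trans (sym (iter-cong t₂ f₂≗f _)) q₂↝v₂)
    v₂→q : f v₂ ≡ head v₁ (cnext (ρ₁ v₁))
    v₂→q = trans (sym (f₂≗f v₂)) (trans (rsucc-turn-self ρ₂ v₂) (sym same-chip))
    v₁≡v₂ : v₁ ≡ v₂
    v₁≡v₂ = unique-predecessor f _ v₁ v₂ t₁ t₂ q↝v₁ (rsucc-turn-self ρ₁ v₁) q↝v₂ v₂→q
    same-old-rotors : ∀ u → ρ₁ u ≡ ρ₂ u
    same-old-rotors u with u Fin.≟ v₁
    ... | yes refl = cnext-injective (trans (sym (turn-self ρ₁ u))
                       (trans (same-rotors u) (subst (λ w → turn ρ₂ w u ≡ cnext (ρ₂ u)) v₁≡v₂ (turn-self ρ₂ u))))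
    ... | no u≢v₁ = trans (sym (turn-other ρ₁ v₁ u u≢v₁))
                      (trans (same-rotors u) (turn-other ρ₂ v₂ u (λ u≡v₂ → u≢v₁ (trans u≡v₂ (sym v₁≡v₂)))))

-- The state space is finite, so every walk is eventually periodic; a walk
-- from a unicycle is purely periodic, with period at most the number K of states.
module Periodicity (G : RibbonDigraph) where
  open RibbonDigraph G
  open RotorWalk G
  open Unicycles G

  -- Dependent functions (v : Fin k) → Fin (d v) are encoded in Fin (∏ d).
  prodN : ∀ {k} → (Fin k → ℕ) → ℕ
  prodN {zero} d = 1
  prodN {suc k} d = d Fin.zero ℕ.* prodN (λ i → d (Fin.suc i))

  encodeΠ : ∀ {k} (d : Fin k → ℕ) → ((v : Fin k) → Fin (d v)) → Fin (prodN d)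
  encodeΠ {zero} d ρ = Fin.zero
  encodeΠ {suc k} d ρ = Fin.combine (ρ Fin.zero) (encodeΠ (λ i → d (Fin.suc i)) (λ i → ρ (Fin.suc i)))

  decodeΠ : ∀ {k} (d : Fin k → ℕ) → Fin (prodN d) → (v : Fin k) → Fin (d v)
  decodeΠ {suc k} d x Fin.zero = proj₁ (Fin.remQuot {d Fin.zero} (prodN (λ i → d (Fin.suc i))) x)
  decodeΠ {suc k} d x (Fin.suc v) = decodeΠ (λ i → d (Fin.suc i)) (proj₂ (Fin.remQuot {d Fin.zero} (prodN (λ i → d (Fin.suc i))) x)) v

  decodeΠ-encodeΠ : ∀ {k} (d : Fin k → ℕ) ρ v → decodeΠ d (encodeΠ d ρ) v ≡ ρ v
  decodeΠ-encodeΠ {suc k} d ρ Fin.zero = cong proj₁ (FinP.remQuot-combine (ρ Fin.zero) _)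
  decodeΠ-encodeΠ {suc k} d ρ (Fin.suc v) =
    trans (cong (λ x → decodeΠ (λ i → d (Fin.suc i)) (proj₂ x) v) (FinP.remQuot-combine (ρ Fin.zero) _))
          (decodeΠ-encodeΠ (λ i → d (Fin.suc i)) (λ i → ρ (Fin.suc i)) v)

  K : ℕ
  K = n ℕ.* prodN outdeg

  encode : State → Fin K
  encode (state v ρ) = Fin.combine v (encodeΠ outdeg ρ)

  decode : Fin K → State
  decode x = state (proj₁ (Fin.remQuot {n} (prodN outdeg) x)) (decodeΠ outdeg (proj₂ (Fin.remQuot {n} (prodN outdeg) x)))

  decode-encode : ∀ s → decode (encode s) ≃ s
  decode-encode (state v ρ) = cong proj₁ (FinP.remQuot-combine v _) ,
    λ u → trans (cong (λ x → decodeΠ outdeg (proj₂ x) u) (FinP.remQuot-combine v (encodeΠ outdeg ρ))) (decodeΠ-encodeΠ outdeg ρ u)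

  encode-injective : ∀ s t → encode s ≡ encode t → s ≃ t
  encode-injective s t eq = ≃-trans (≃-sym (decode-encode s)) (≃-trans (≃-reflexive (cong decode eq)) (decode-encode t))

  run-repeats : ∀ s → ∃₂ λ i j → i < j × j ≤ K × run i s ≃ run j s
  run-repeats s with FinP.pigeonhole (ℕP.n<1+n K) (λ (i : Fin (suc K)) → encode (run (toℕ i) s))
  ... | i , j , i<j , same = toℕ i , toℕ j , i<j , ℕP.≤-pred (FinP.toℕ<n j) , encode-injective _ _ same

  Periodic : State → ℕ → Set
  Periodic s l = s ≃ run (suc l) s

  eventually-periodic : ∀ s → ∃₂ λ i l → Periodic (run i s) l
  eventually-periodic s with run-repeats s
  ... | i , j , i<j , _ , same = i , j ∸ suc i , ≃-trans same (≃-reflexive (trans (cong (λ t → run t s) (sym gap)) (run-+ (suc (j ∸ suc i)) i s)))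
    where
    gap : suc (j ∸ suc i) ℕ.+ i ≡ j
    gap = trans (cong (ℕ._+ i) (sym (ℕP.+-∸-assoc 1 i<j))) (ℕP.m∸n+n≡m (ℕP.<⇒≤ i<j))

  -- injectivity of the step on unicycles lets a repetition be moved back to the start
  unicycle-cancel : ∀ s → IsUnicycle s → ∀ i m → run i s ≃ run (i ℕ.+ m) s → s ≃ run m s
  unicycle-cancel s uni zero m same = same
  unicycle-cancel s uni (suc i) m same =
    unicycle-cancel s uni i m (move-injective _ _ (run-unicycle i s uni) (run-unicycle (i ℕ.+ m) s uni) same)

  unicycle-periodic : ∀ s → IsUnicycle s → ∃ λ l → suc l ≤ K × Periodic s l
  unicycle-periodic s uni with run-repeats s
  ... | i , j , i<j , j≤K , same = j ∸ suc i , period≤K ,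
        unicycle-cancel s uni i (suc (j ∸ suc i)) (≃-trans same (≃-reflexive (cong (λ t → run t s) (sym gap))))
    where
    gap : i ℕ.+ suc (j ∸ suc i) ≡ j
    gap = trans (ℕP.+-comm i _) (trans (cong (ℕ._+ i) (sym (ℕP.+-∸-assoc 1 i<j))) (ℕP.m∸n+n≡m (ℕP.<⇒≤ i<j)))
    period≤K : suc (j ∸ suc i) ≤ K
    period≤K = ℕP.≤-trans (ℕP.≤-reflexive (sym (ℕP.+-∸-assoc 1 i<j))) (ℕP.≤-trans (ℕP.m∸n≤m j i) j≤K)

  periodic-repeat : ∀ s L → s ≃ run L s → ∀ m → run (m ℕ.* L) s ≃ s
  periodic-repeat s L per zero = ≃-refl
  periodic-repeat s L per (suc m) =
    ≃-trans (≃-reflexive (run-+ L (m ℕ.* L) s)) (≃-trans (run-cong L (periodic-repeat s L per m)) (≃-sym per))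

  periodic-reduce : ∀ s l → Periodic s l → ∀ k → ∃ λ k′ → k′ < suc l × run k s ≃ run k′ s
  periodic-reduce s l per zero = 0 , s≤s z≤n , ≃-refl
  periodic-reduce s l per (suc k) with periodic-reduce s l per k
  ... | k′ , k′<p , same with suc k′ ℕ.≟ suc l
  ... | yes k′+1≡p = 0 , s≤s z≤n , ≃-trans (move-cong same) (≃-trans (≃-reflexive (cong (λ t → run t s) k′+1≡p)) (≃-sym per))
  ... | no k′+1≢p = suc k′ , ℕP.≤∧≢⇒< k′<p k′+1≢p , move-cong same

  periodic-return : ∀ s l → Periodic s l → ∀ k → run (k ℕ.* l) (run k s) ≃ s
  periodic-return s l per k = ≃-trans (≃-reflexive (sym (run-+ (k ℕ.* l) k s)))
    (≃-trans (≃-reflexive (cong (λ t → run t s) total)) (periodic-repeat s (suc l) per k))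
    where
    total : k ℕ.* l ℕ.+ k ≡ k ℕ.* suc l
    total = trans (ℕP.+-comm (k ℕ.* l) k) (sym (ℕP.*-suc k l))

module Exploration (G : RibbonDigraph) (strong : StronglyConnected G) where
  open RibbonDigraph G
  open RotorWalk G
  open Unicycles G
  open Periodicity G
  open CyclicOrder using (cnext^; cnext^-surjective)

  first-visit : ∀ v m s → chip (run m s) ≡ v → ∃ λ j → chip (run j s) ≡ v × rotors (run j s) v ≡ rotors s v
  first-visit v m s at-v with chip s Fin.≟ v
  ... | yes here-v = 0 , here-v , refl
  first-visit v zero s at-v | no not-v = ⊥-elim (not-v at-v)
  first-visit v (suc m) s at-v | no not-v with first-visit v m (move s) (trans (cong chip (run-suc m s)) at-v)
  ... | j , at-v′ , same = suc j , trans (cong chip (sym (run-suc j s))) at-v′ ,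
        trans (cong (λ t → rotors t v) (sym (run-suc j s))) (trans same (turn-other (rotors s) (chip s) v (λ eq → not-v (sym eq))))

  module PeriodicWalk (τ : State) (l : ℕ) (per : Periodic τ l) where

    Visited : Fin n → Set
    Visited v = ∃ λ k → chip (run k τ) ≡ v

    Used : (v : Fin n) → Fin (outdeg v) → Set
    Used v e = ∃ λ k → chip (run k τ) ≡ v × cnext (rotors (run k τ) v) ≡ e

    used⇒visited : ∀ v e → Used v e → Visited (head v e)
    used⇒visited v e (k , refl , refl) = suc k , refl

    -- by periodicity the chip comes back to v, and then uses the next edge
    used-next : ∀ v e → Used v e → Used v (cnext e)
    used-next v e (k , at-v , used) with first-visit v l (run (suc k) τ) back
      where
      back : chip (run l (run (suc k) τ)) ≡ v
      back = trans (cong chip (sym (run-+ l (suc k) τ)))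
               (trans (cong (λ t → chip (run t τ)) (trans (ℕP.+-comm l (suc k)) (sym (ℕP.+-suc k l))))
               (trans (cong chip (run-+ k (suc l) τ)) (trans (proj₁ (run-cong k (≃-sym per))) at-v)))
    ... | j , at-v′ , same = j ℕ.+ suc k , trans (cong chip (run-+ j (suc k) τ)) at-v′ ,
          cong cnext (trans (cong (λ t → rotors t v) (run-+ j (suc k) τ)) (trans same (trans (turned at-v) used)))
      where
      turned : chip (run k τ) ≡ v → rotors (run (suc k) τ) v ≡ cnext (rotors (run k τ) v)
      turned refl = turn-self (rotors (run k τ)) (chip (run k τ))

    used-all : ∀ v e j → Used v e → Used v (cnext^ j e)
    used-all v e zero used = used
    used-all v e (suc j) used = used-next v _ (used-all v e j used)

    visited-edge : ∀ v → Visited v → ∀ e → Visited (head v e)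
    visited-edge v (k , at-v) e with cnext^-surjective (cnext (rotors (run k τ) v)) e
    ... | j , reaches-e = used⇒visited v e (subst (Used v) reaches-e (used-all v _ j (k , at-v , refl)))

    visited-walk : ∀ {u w} → Walk G u w → Visited u → Visited w
    visited-walk here visited = visited
    visited-walk (edge e rest) visited = visited-walk rest (visited-edge _ visited e)

  visits-all : ∀ s z → ∃ λ k → chip (run k s) ≡ z
  visits-all s z with eventually-periodic s
  ... | i , l , per with PeriodicWalk.visited-walk (run i s) l per (strong (chip (run i s)) z) (0 , refl)
  ... | k , at-z = k ℕ.+ i , trans (cong chip (run-+ k i s)) at-z

  Explored : State → ℕ → Set
  Explored s t = ∀ u → (∃ λ t′ → t′ < t × chip (run t′ s) ≡ u) →
    ∃ λ j → iter G j (rsucc G (rotors (run t s))) u ≡ chip (run t s)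

  explored : ∀ s t → Explored s t
  explored s zero u (t′ , () , _)
  explored s (suc t) u (t′ , t′<t+1 , at-u) with t′ ℕ.≟ t
  ... | yes refl = 1 , trans (cong (rsucc G (rotors (run (suc t) s))) (sym at-u)) (rsucc-turn-self (rotors (run t s)) (chip (run t s)))
  ... | no t′≢t with explored s t u (t′ , ℕP.≤∧≢⇒< (ℕP.≤-pred t′<t+1) t′≢t , at-u)
  ...   | j , u↝chip = reach-chip-after-move (run t s) u j u↝chip

  eventually-unicycle : ∀ s → ∃ λ T → IsUnicycle (run T s)
  eventually-unicycle s = T , λ u → explored s T u (time u , s≤s (term≤sumN time u) , proj₂ (visits-all s u))
    where
    open NatSums using (sumN; term≤sumN)
    time : Fin n → ℕ
    time z = proj₁ (visits-all s z)
    T = suc (sumN time)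

  OnWalk : State → State → Set
  OnWalk s t = ∃ λ k → run k s ≃ t

  on-walk-trans : ∀ {s t u} → OnWalk s t → OnWalk t u → OnWalk s u
  on-walk-trans {s} (k₁ , s↝t) (k₂ , t↝u) = k₂ ℕ.+ k₁ , ≃-trans (≃-reflexive (run-+ k₂ k₁ s)) (≃-trans (run-cong k₂ s↝t) t↝u)

  -- the walk from a unicycle is a cycle, so being on it is symmetric ...
  on-walk-sym : ∀ s → IsUnicycle s → ∀ t → OnWalk s t → OnWalk t s
  on-walk-sym s unicycle t (k , s↝t) with unicycle-periodic s unicycle
  ... | l , _ , per = k ℕ.* l , ≃-trans (run-cong (k ℕ.* l) (≃-sym s↝t)) (periodic-return s l per k)

  -- ... and decidable, by searching its first K states
  on-walk? : ∀ s → IsUnicycle s → ∀ t → Dec (OnWalk s t)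
  on-walk? s unicycle t with unicycle-periodic s unicycle | FinP.any? (λ (i : Fin K) → run (toℕ i) s ≟ₛ t)
  ... | _ | yes (i , found) = yes (toℕ i , found)
  ... | l , p≤K , per | no none = no absent
    where
    absent : ¬ OnWalk s t
    absent (k , s↝t) with periodic-reduce s l per k
    ... | k′ , k′<p , same = none (Fin.fromℕ< k′<K , ≃-trans (≃-reflexive (cong (λ j → run j s) (FinP.toℕ-fromℕ< k′<K))) (≃-trans (≃-sym same) s↝t))
      where k′<K = ℕP.<-≤-trans k′<p p≤K

-- Unconstrained routing commutes, so the result of any
-- sequence of routings from A only depends on how often each vertex was
-- routed: it is routeBy a A for a vector a : Fin n → ℕ.
module RoutingVectors (G : RibbonDigraph) where
  open RibbonDigraph G
  open Configurations G
  open CyclicOrder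
  open NatSums

  δ : Fin n → Fin n → ℕ
  δ h u = if ⌊ u Fin.≟ h ⌋ then 1 else 0

  ind≡δ : ∀ h u → ind G h u ≡ + δ h u
  ind≡δ h u with u Fin.≟ h
  ... | yes _ = refl
  ... | no _ = refl

  δ-self : ∀ u → δ u u ≡ 1
  δ-self u with u Fin.≟ u
  ... | yes _ = refl
  ... | no u≢u = ⊥-elim (u≢u refl)

  δ-other : ∀ h u → u ≢ h → δ h u ≡ 0
  δ-other h u u≢h with u Fin.≟ h
  ... | yes u≡h = ⊥-elim (u≢h u≡h)
  ... | no _ = refl

  sent : (v : Fin n) → Fin (outdeg v) → ℕ → Fin n → ℕ
  sent v r zero u = 0
  sent v r (suc m) u = sent v r m u ℕ.+ δ (head v (cnext^ (suc m) r)) u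

  received : (Fin n → ℕ) → Rotor G → Fin n → ℕ
  received a ρ u = sumN (λ v → sent v (ρ v) (a v) u)

  routeBy : (Fin n → ℕ) → DRC G → DRC G
  routeBy a A = drc (λ u → div A u ℤ.- + a u ℤ.+ + received a (rot A) u) (λ v → cnext^ (a v) (rot A v))

  bump : (Fin n → ℕ) → Fin n → Fin n → ℕ
  bump a v u = δ v u ℕ.+ a u

  bump-self : ∀ a v → bump a v v ≡ suc (a v)
  bump-self a v = cong (ℕ._+ a v) (δ-self v)

  bump-other : ∀ a v u → u ≢ v → bump a v u ≡ a u
  bump-other a v u u≢v = cong (ℕ._+ a u) (δ-other v u u≢v)

  routeBy-zero : ∀ A → routeBy (λ _ → 0) A ≋ A
  routeBy-zero A = (λ u → trans (cong (λ r → div A u ℤ.- + 0 ℤ.+ + r) (sumN-zero {n})) (no-change (div A u))) , (λ u → refl)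
    where
    no-change : ∀ (x : ℤ) → x ℤ.- + 0 ℤ.+ + 0 ≡ x
    no-change = solve-∀

  received-bump : ∀ a ρ v u → received (bump a v) ρ u ≡ received a ρ u ℕ.+ δ (head v (cnext^ (suc (a v)) (ρ v))) u
  received-bump a ρ v u = sumN-raise _ _ v _
    (λ w w≢v → cong (λ m → sent w (ρ w) m u) (bump-other a v w w≢v))
    (cong (λ m → sent v (ρ v) m u) (bump-self a v))

  routeBy-bump : ∀ a v A → Route G v (routeBy a A) (routeBy (bump a v) A)
  routeBy-bump a v A = rotors-turned , divisor-moved
    where
    last = head v (cnext (cnext^ (a v) (rot A v)))
    rotors-turned : ∀ u → cnext^ (bump a v u) (rot A u) ≡
      (if ⌊ u Fin.≟ v ⌋ then cnext (cnext^ (a u) (rot A u)) else cnext^ (a u) (rot A u))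
    rotors-turned u with u Fin.≟ v
    ... | yes _ = refl
    ... | no _ = refl
    rearrange : ∀ (x a d r δl : ℤ) → x ℤ.- (d ℤ.+ a) ℤ.+ (r ℤ.+ δl) ≡ x ℤ.- a ℤ.+ r ℤ.- d ℤ.+ δl
    rearrange = solve-∀
    divisor-moved : ∀ u → div A u ℤ.- + bump a v u ℤ.+ + received (bump a v) (rot A) u ≡
      div A u ℤ.- + a u ℤ.+ + received a (rot A) u ℤ.- ind G v u ℤ.+ ind G last u
    divisor-moved u rewrite received-bump a (rot A) v u | ind≡δ v u | ind≡δ last u =
      rearrange (div A u) (+ a u) (+ δ v u) (+ received a (rot A) u) (+ δ last u)

  routeBy-cong : ∀ a a′ A A′ → (∀ v → a v ≡ a′ v) → A ≋ A′ → routeBy a A ≋ routeBy a′ A′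
  routeBy-cong a a′ A A′ a≗a′ (d , r) =
    (λ u → cong₂ ℤ._+_ (cong₂ ℤ._-_ (d u) (cong +_ (a≗a′ u))) (cong +_ (sumN-cong _ _ (λ v → cong₂ (λ r m → sent v r m u) (r v) (a≗a′ v))))) ,
    (λ v → cong₂ cnext^ (a≗a′ v) (r v))

  reach⇒routeBy : ∀ {B C} → Reach G (UnconstrainedStep G) B C → ∀ A b → B ≋ routeBy b A → ∃ λ a → C ≋ routeBy a A
  reach⇒routeBy (done B≋C) A b B≋ = b , ≋-trans (≋-sym B≋C) B≋
  reach⇒routeBy {B} (step (v , r) rs) A b B≋ =
    reach⇒routeBy rs A (bump b v) (route-functional B r (route-respˡ (≋-sym B≋) (routeBy-bump b v A)))

  sent-mono : ∀ v r {m m′} u → m ≤ m′ → sent v r m u ≤ sent v r m′ u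
  sent-mono v r u m≤m′ = go (ℕP.≤⇒≤′ m≤m′)
    where
    go : ∀ {m m′} → m ℕ.≤′ m′ → sent v r m u ≤ sent v r m′ u
    go ℕ.≤′-refl = ℕP.≤-refl
    go (ℕ.≤′-step m≤′m′) = ℕP.≤-trans (go m≤′m′) (ℕP.m≤m+n _ _)

  sent-last : ∀ v r c M → c < M → sent v r c (head v (cnext^ M r)) ℕ.+ 1 ≤ sent v r M (head v (cnext^ M r))
  sent-last v r c (suc m) (s≤s c≤m) =
    ℕP.≤-trans (ℕP.+-monoˡ-≤ 1 (sent-mono v r _ c≤m)) (ℕP.≤-reflexive (cong (sent v r m last ℕ.+_) (sym (δ-self last))))
    where last = head v (cnext^ (suc m) r)

  received-mono : ∀ a c ρ u → (∀ v → c v ≤ a v) → received c ρ u ≤ received a ρ u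
  received-mono a c ρ u c≤a = sumN-mono _ _ (λ v → sent-mono v (ρ v) u (c≤a v))

  received-last : ∀ a c ρ z → (∀ v → c v ≤ a v) → c z < a z →
    received c ρ (head z (cnext^ (a z) (ρ z))) ℕ.+ 1 ≤ received a ρ (head z (cnext^ (a z) (ρ z)))
  received-last a c ρ z c≤a cz<az = sumN-mono-gap _ _ z 1 (λ v → sent-mono v (ρ v) _ (c≤a v)) (sent-last z (ρ z) (c z) (a z) cz<az)

  routeBy-gain : ∀ a c A y → a y ≡ c y → ∀ r → received c (rot A) y ℕ.+ r ≡ received a (rot A) y →
    div (routeBy a A) y ≡ div (routeBy c A) y ℤ.+ + r
  routeBy-gain a c A y ay≡cy r gained rewrite ay≡cy | sym gained =
    regroup (div A y) (+ c y) (+ received c (rot A) y) (+ r)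
    where
    regroup : ∀ (x cy rc r : ℤ) → x ℤ.- cy ℤ.+ (rc ℤ.+ r) ≡ x ℤ.- cy ℤ.+ rc ℤ.+ r
    regroup = solve-∀

-- The walk routes each vertex at most a times; it can only stop
-- short of a at a vertex already routed a times, and there the unicycle
-- structure of t forces every vertex to have been routed a times.
module LeastAction (G : RibbonDigraph) where
  open RibbonDigraph G
  open Configurations G
  open RotorWalk G
  open FunctionalGraph G
  open Unicycles G
  open RoutingVectors G
  open CyclicOrder using (cnext^)
  open NatSums

  module _ (U : DRC G) (a : Fin n → ℕ) (t : State) (target : routeBy a U ≋ config t) (unicycle : IsUnicycle t) where

    module Partial (c : Fin n → ℕ) (c≤a : ∀ v → c v ≤ a v) (s : State) (current : routeBy c U ≋ config s) where

      chips-gained : ∀ y → a y ≡ c y → ∀ r → received c (rot U) y ℕ.+ r ≡ received a (rot U) y →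
        ind G (chip t) y ≡ ind G (chip s) y ℤ.+ + r
      chips-gained y ay≡cy r gained = trans (sym (proj₁ target y))
        (trans (routeBy-gain a c U y ay≡cy r gained) (cong (ℤ._+ + r) (proj₁ current y)))

      same-chip : a (chip s) ≡ c (chip s) → chip t ≡ chip s
      same-chip full with chip t Fin.≟ chip s | ℕP.m≤n⇒∃[o]m+o≡n (received-mono a c (rot U) (chip s) c≤a)
      ... | yes eq | _ = eq
      ... | no differ | r , gained
        with trans (sym (ind-other (chip t) (chip s) (λ eq → differ (sym eq))))
               (trans (chips-gained (chip s) full r gained) (cong (ℤ._+ + r) (ind-self (chip s))))
      ...   | ()

      target-successor : ∀ z → rsucc G (rotors t) z ≡ head z (cnext^ (a z) (rot U z))
      target-successor z = cong (head z) (sym (proj₂ target z))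

      no-exit : chip t ≡ chip s → ∀ z → c z < a z → ¬ (a (rsucc G (rotors t) z) ≡ c (rsucc G (rotors t) z))
      no-exit t≡s z cz<az full-y = adding-chips-changes-nothing more
        where
        y = head z (cnext^ (a z) (rot U z))
        extra : ∃ λ r → received c (rot U) y ℕ.+ 1 ℕ.+ r ≡ received a (rot U) y
        extra = ℕP.m≤n⇒∃[o]m+o≡n (received-last a c (rot U) z c≤a cz<az)
        r = proj₁ extra
        more : ind G (chip s) y ≡ ind G (chip s) y ℤ.+ + suc r
        more = subst (λ w → ind G w y ≡ ind G (chip s) y ℤ.+ + suc r) t≡s
          (chips-gained y (subst (λ x → a x ≡ c x) (target-successor z) full-y) (suc r)
            (trans (sym (ℕP.+-assoc _ 1 r)) (proj₂ extra)))
        adding-chips-changes-nothing : ∀ {x : ℤ} → x ≡ x ℤ.+ + suc r → ⊥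
        adding-chips-changes-nothing {x} eq =
          ℤP.<-irrefl (trans (ℤP.+-identityʳ x) eq) (ℤP.+-monoʳ-< x (ℤ.+<+ (s≤s z≤n)))

      -- every rotor path of t ends at the (fully routed) chip, so a path from a vertex
      -- that is not fully routed would leave that set along a rotor, which no-exit forbids
      saturated : a (chip s) ≡ c (chip s) → ∀ v → a v ≡ c v
      saturated full with FinP.any? (λ v → c v ℕ.<? a v)
      ... | no none = λ v → ℕP.≤-antisym (ℕP.≮⇒≥ (λ cv<av → none (v , cv<av))) (c≤a v)
      ... | yes (z₀ , lt) with exit (λ v → c v < a v) (λ v → c v ℕ.<? a v) (rsucc G (rotors t)) j z₀ lt
                                 (λ lt′ → ℕP.<-irrefl (sym full) (subst (λ v → c v < a v) (trans z₀↝ (same-chip full)) lt′))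
        where
        j = proj₁ (unicycle z₀)
        z₀↝ = proj₂ (unicycle z₀)
      ... | z , cz<az , ¬lt = ⊥-elim (no-exit (same-chip full) z cz<az
                                (ℕP.≤-antisym (ℕP.≮⇒≥ (λ lt′ → ¬lt lt′)) (c≤a _)))

    routeBy-move : ∀ c s → routeBy c U ≋ config s → routeBy (bump c (chip s)) U ≋ config (move s)
    routeBy-move c s current = route-functional (config s) (route-respˡ current (routeBy-bump c (chip s) U)) (route-config s)

    bump-below : ∀ c v → (∀ u → c u ≤ a u) → c v < a v → ∀ u → bump c v u ≤ a u
    bump-below c v c≤a cv<av u with u Fin.≟ v
    ... | yes refl = cv<av
    ... | no _ = c≤a u

    sum-bump : ∀ c v → sumN (bump c v) ≡ sumN c ℕ.+ 1
    sum-bump c v = sumN-raise _ _ v 1 (bump-other c v) (trans (bump-self c v) (ℕP.+-comm 1 (c v)))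

    room : ∀ c v → (∀ u → c u ≤ a u) → c v < a v → sumN c < sumN a
    room c v c≤a cv<av = subst (_≤ sumN a) (ℕP.+-comm (sumN c) 1)
      (sumN-mono-gap a c v 1 c≤a (subst (_≤ a v) (ℕP.+-comm 1 (c v)) cv<av))

    -- the rotor walk, with c counting the routings done so far and fuel = Σa − Σc
    walk : ∀ fuel s c → (∀ v → c v ≤ a v) → routeBy c U ≋ config s → sumN c ℕ.+ fuel ≡ sumN a →
      Reach G (LegalStep G) (config s) (config t)
    walk fuel s c c≤a current total with ℕP.m≤n⇒m<n∨m≡n (c≤a (chip s))
    ... | inj₂ full = done (≋-trans (≋-sym current)
          (≋-trans (routeBy-cong c a U U (λ v → sym (Partial.saturated c c≤a s current (sym full) v)) ≋-refl) target))
    walk zero s c c≤a current total | inj₁ cp<ap =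
      ⊥-elim (ℕP.<-irrefl (trans (sym (ℕP.+-identityʳ (sumN c))) total) (room c (chip s) c≤a cp<ap))
    walk (suc fuel) s c c≤a current total | inj₁ cp<ap =
      step (legal-config s) (walk fuel (move s) (bump c (chip s)) (bump-below c (chip s) c≤a cp<ap) (routeBy-move c s current)
        (trans (cong (ℕ._+ fuel) (sum-bump c (chip s))) (trans (ℕP.+-assoc (sumN c) 1 fuel) total)))

  least-action : ∀ s₀ a t → routeBy a (config s₀) ≋ config t → IsUnicycle t → Reach G (LegalStep G) (config s₀) (config t)
  least-action s₀ a t target unicycle = walk (config s₀) a t target unicycle (sumN a) s₀ (λ _ → 0) (λ v → z≤n)
    (routeBy-zero (config s₀)) (cong (ℕ._+ sumN a) (sumN-zero {n}))

module Degree (G : RibbonDigraph) where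
  open RibbonDigraph G
  open RoutingVectors G using (δ; ind≡δ; δ-self; δ-other)
  open NatSums

  sumFin-cong : ∀ {k} (f g : Fin k → ℤ) → (∀ u → f u ≡ g u) → sumFin G f ≡ sumFin G g
  sumFin-cong {zero} f g f≗g = refl
  sumFin-cong {suc k} f g f≗g = cong₂ ℤ._+_ (f≗g Fin.zero) (sumFin-cong _ _ (λ i → f≗g (Fin.suc i)))

  sumFin-+ : ∀ {k} (f : Fin k → ℕ) → sumFin G (λ u → + f u) ≡ + sumN f
  sumFin-+ {zero} f = refl
  sumFin-+ {suc k} f = cong (λ r → + f Fin.zero ℤ.+ r) (sumFin-+ (λ i → f (Fin.suc i)))

  sumFin-nonpositive : ∀ {k} (f : Fin k → ℤ) → (∀ u → f u ℤ.≤ + 0) → sumFin G f ℤ.≤ + 0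
  sumFin-nonpositive {zero} f f≤0 = ℤP.≤-refl
  sumFin-nonpositive {suc k} f f≤0 = ℤP.+-mono-≤ (f≤0 Fin.zero) (sumFin-nonpositive (λ i → f (Fin.suc i)) (λ i → f≤0 (Fin.suc i)))

  sumFin-linear : ∀ {k} (f g h : Fin k → ℤ) → sumFin G (λ u → f u ℤ.- g u ℤ.+ h u) ≡ sumFin G f ℤ.- sumFin G g ℤ.+ sumFin G h
  sumFin-linear {zero} f g h = refl
  sumFin-linear {suc k} f g h =
    trans (cong (λ r → f Fin.zero ℤ.- g Fin.zero ℤ.+ h Fin.zero ℤ.+ r) (sumFin-linear (λ i → f (Fin.suc i)) (λ i → g (Fin.suc i)) (λ i → h (Fin.suc i))))
          (regroup (f Fin.zero) (g Fin.zero) (h Fin.zero) _ _ _)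
    where
    regroup : ∀ (a b c d e f : ℤ) → a ℤ.- b ℤ.+ c ℤ.+ (d ℤ.- e ℤ.+ f) ≡ a ℤ.+ d ℤ.- (b ℤ.+ e) ℤ.+ (c ℤ.+ f)
    regroup = solve-∀

  deg-ind : ∀ v → deg G (ind G v) ≡ + 1
  deg-ind v = trans (sumFin-cong _ _ (ind≡δ v)) (trans (sumFin-+ (δ v))
    (cong +_ (trans (sumN-raise (δ v) (λ _ → 0) v 1 (δ-other v) (δ-self v)) (cong (ℕ._+ 1) (sumN-zero {n})))))

  deg-transfer : ∀ (x y : Divisor G) v z → (∀ u → y u ≡ x u ℤ.- ind G v u ℤ.+ ind G z u) → deg G y ≡ deg G x
  deg-transfer x y v z moved = trans (sumFin-cong _ _ moved) (trans (sumFin-linear x (ind G v) (ind G z))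
    (trans (cong₂ (λ p q → deg G x ℤ.- p ℤ.+ q) (deg-ind v) (deg-ind z)) (cancel (deg G x))))
    where
    cancel : ∀ (d : ℤ) → d ℤ.- + 1 ℤ.+ + 1 ≡ d
    cancel = solve-∀

  sumN≡1 : ∀ {k} (f : Fin k → ℕ) → sumN f ≡ 1 → ∃ λ i → f i ≡ 1 × (∀ u → u ≢ i → f u ≡ 0)
  sumN≡1 {suc k} f total with f Fin.zero in f0
  ... | suc zero = Fin.zero , f0 , λ where
        Fin.zero 0≢0 → ⊥-elim (0≢0 refl)
        (Fin.suc u) _ → ℕP.n≤0⇒n≡0 (subst (f (Fin.suc u) ≤_) (ℕP.suc-injective total) (term≤sumN (λ i → f (Fin.suc i)) u))
  sumN≡1 {suc k} f () | suc (suc _)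
  ... | zero with sumN≡1 (λ i → f (Fin.suc i)) total
  ...   | i , fi≡1 , others = Fin.suc i , fi≡1 , λ where
          Fin.zero _ → f0
          (Fin.suc u) u≢i → others u (λ eq → u≢i (cong Fin.suc eq))

-- Every configuration of degree 1 reaches, by unconstrained routing, the
-- one-chip configuration of a unicycle: while some vertex is in debt, walk a
-- chip from a vertex with chips to it; once no vertex is in debt there is a
-- single chip, and its rotor walk turns the rotors into a unicycle.
module DegreeOne (G : RibbonDigraph) (strong : StronglyConnected G) where
  open RibbonDigraph G
  open Configurations G
  open RotorWalk G
  open Unicycles G
  open Exploration G strong
  open Degree G
  open NatSums

  -- one chip walking on top of a fixed background divisor y
  over : Divisor G → State → DRC G
  over y s = drc (λ u → y u ℤ.+ ind G (chip s) u) (rotors s)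

  route-over : ∀ y s → Route G (chip s) (over y s) (over y (move s))
  route-over y (state v ρ) = (λ u → refl) , (λ u → shift (y u) (ind G v u) _)
    where
    shift : ∀ (y a b : ℤ) → y ℤ.+ b ≡ y ℤ.+ a ℤ.- a ℤ.+ b
    shift = solve-∀

  run-over : ∀ y k s → Reach G (UnconstrainedStep G) (over y s) (over y (run k s))
  run-over y zero s = done ≋-refl
  run-over y (suc k) s = reach-trans unconstrained-respˡ (run-over y k s)
    (step (chip (run k s) , route-over y (run k s)) (done ≋-refl))

  transfer : ∀ A v z → + 0 ℤ.< div A v → ∃ λ A′ →
    Reach G (UnconstrainedStep G) A A′ × (∀ u → div A′ u ≡ div A u ℤ.- ind G v u ℤ.+ ind G z u)
  transfer A v z _ with visits-all (state v (rot A)) z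
  ... | k , at-z = over y (run k s) , reach-respˡ unconstrained-respˡ (≋-sym A≋) (run-over y k s) ,
                   (λ u → cong (λ w → y u ℤ.+ ind G w u) at-z)
    where
    s = state v (rot A)
    y = λ u → div A u ℤ.- ind G v u
    split : ∀ (x a : ℤ) → x ≡ x ℤ.- a ℤ.+ a
    split = solve-∀
    A≋ : A ≋ over y s
    A≋ = (λ u → split (div A u) (ind G v u)) , (λ u → refl)

  owed : ℤ → ℕ
  owed (+ _) = 0
  owed -[1+ m ] = suc m

  debt : DRC G → ℕ
  debt A = sumN (λ u → owed (div A u))

  owed-positive : ∀ x → + 0 ℤ.< x → owed x ≡ 0
  owed-positive (+ _) _ = refl

  owed-give : ∀ x → + 0 ℤ.< x → owed (x ℤ.- + 1 ℤ.+ + 0) ≡ owed x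
  owed-give (+ suc m) _ = refl
  owed-give (+ zero) (ℤ.+<+ ())

  owed-keep : ∀ x → owed (x ℤ.- + 0 ℤ.+ + 0) ≡ owed x
  owed-keep x = cong owed (no-change x)
    where
    no-change : ∀ (x : ℤ) → x ℤ.- + 0 ℤ.+ + 0 ≡ x
    no-change = solve-∀

  owed-receive : ∀ x → owed x ≢ 0 → owed x ≡ owed (x ℤ.- + 0 ℤ.+ + 1) ℕ.+ 1
  owed-receive (+ _) owes = ⊥-elim (owes refl)
  owed-receive -[1+ zero ] _ = refl
  owed-receive -[1+ suc m ] _ = cong suc (ℕP.+-comm 1 m)

  debt-transfer : ∀ A A′ v z → + 0 ℤ.< div A v → owed (div A z) ≢ 0 →
    (∀ u → div A′ u ≡ div A u ℤ.- ind G v u ℤ.+ ind G z u) → debt A ≡ debt A′ ℕ.+ 1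
  debt-transfer A A′ v z positive owing moved = sumN-raise _ _ z 1 unchanged paid
    where
    moved-by : ∀ u {p q} → ind G v u ≡ p → ind G z u ≡ q → div A′ u ≡ div A u ℤ.- p ℤ.+ q
    moved-by u refl refl = moved u
    v≢z : v ≢ z
    v≢z refl = owing (owed-positive (div A v) positive)
    unchanged : ∀ u → u ≢ z → owed (div A u) ≡ owed (div A′ u)
    unchanged u u≢z with u Fin.≟ v
    ... | yes refl = sym (trans (cong owed (moved-by u (ind-self u) (ind-other z u u≢z))) (owed-give (div A u) positive))
    ... | no u≢v = sym (trans (cong owed (moved-by u (ind-other v u u≢v) (ind-other z u u≢z))) (owed-keep (div A u)))
    paid : owed (div A z) ≡ owed (div A′ z) ℕ.+ 1
    paid = trans (owed-receive (div A z) owing)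
      (cong (λ x → owed x ℕ.+ 1) (sym (moved-by z (ind-other v z (λ eq → v≢z (sym eq))) (ind-self z))))

  debt-free⇒nonnegative : ∀ A → debt A ≡ 0 → ∀ u → div A u ≡ + ∣ div A u ∣
  debt-free⇒nonnegative A no-debt u = as-natural (div A u) (ℕP.n≤0⇒n≡0 (subst (owed (div A u) ≤_) no-debt (term≤sumN _ u)))
    where
    as-natural : ∀ x → owed x ≡ 0 → x ≡ + ∣ x ∣
    as-natural (+ _) _ = refl

  debt-free : ∀ A → debt A ≡ 0 → deg G (div A) ≡ + 1 → ∃ λ w → A ≋ config (state w (rot A))
  debt-free A no-debt degree with sumN≡1 (λ u → ∣ div A u ∣) (ℤP.+-injective total)
    where
    total : + sumN (λ u → ∣ div A u ∣) ≡ + 1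
    total = trans (sym (sumFin-+ (λ u → ∣ div A u ∣))) (trans (sumFin-cong _ _ (λ u → sym (debt-free⇒nonnegative A no-debt u))) degree)
  ... | w , at-w , elsewhere = w , single , (λ u → refl)
    where
    single : ∀ u → div A u ≡ ind G w u
    single u with u Fin.≟ w
    ... | yes refl = trans (debt-free⇒nonnegative A no-debt u) (cong +_ at-w)
    ... | no u≢w = trans (debt-free⇒nonnegative A no-debt u) (cong +_ (elsewhere u u≢w))

  has-chip : ∀ (A : DRC G) → deg G (div A) ≡ + 1 → ∃ λ v → + 0 ℤ.< div A v
  has-chip A degree with FinP.any? (λ (v : Fin n) → + 0 ℤP.<? div A v)
  ... | yes found = found
  ... | no none with subst (ℤ._≤ + 0) degree (sumFin-nonpositive (div A) (λ v → ℤP.≮⇒≥ (λ pos → none (v , pos))))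
  ...   | ℤ.+≤+ ()

  owing-vertex : ∀ (A : DRC G) d → debt A ≡ suc d → ∃ λ z → owed (div A z) ≢ 0
  owing-vertex A d in-debt with FinP.any? (λ (z : Fin n) → ¬? (owed (div A z) ℕ.≟ 0))
  ... | yes found = found
  ... | no none with trans (sym in-debt) (trans (sumN-cong _ _ settled) (sumN-zero {n}))
    where
    settled : ∀ z → owed (div A z) ≡ 0
    settled z with owed (div A z) ℕ.≟ 0
    ... | yes eq = eq
    ... | no owes = ⊥-elim (none (z , owes))
  ...   | ()

  reach-unicycle : ∀ d (A : DRC G) → debt A ≡ d → deg G (div A) ≡ + 1 → ∃ λ s → IsUnicycle s × Reach G (UnconstrainedStep G) A (config s)
  reach-unicycle zero A no-debt degree with debt-free A no-debt degree
  ... | w , A≋ with eventually-unicycle (state w (rot A))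
  ... | T , unicycle = run T (state w (rot A)) , unicycle ,
        reach-respˡ unconstrained-respˡ (≋-sym A≋) (legal⇒unconstrained (run-legal T (state w (rot A))))
  reach-unicycle (suc d) A in-debt degree with owing-vertex A d in-debt | has-chip A degree
  ... | z , owes | v , positive with transfer A v z positive
  ... | A′ , A↝A′ , moved with reach-unicycle d A′ smaller (trans (deg-transfer (div A) (div A′) v z moved) degree)
    where
    smaller : debt A′ ≡ d
    smaller = ℕP.suc-injective (trans (trans (ℕP.+-comm 1 _) (sym (debt-transfer A A′ v z positive owes moved))) in-debt)
  ... | s , unicycle , A′↝s = s , unicycle , reach-trans unconstrained-respˡ A↝A′ A′↝s

-- Every DRC of degree 1 is linearly equivalent to the one-chip
-- configuration of a unicycle, and between unicycles linear equivalence
-- coincides with lying in the same rotor-router orbit.  One transversal of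
-- the orbits of the walks from unicycles therefore counts both kinds of classes.
module Counting (G : RibbonDigraph) (strong : StronglyConnected G) where
  open Configurations G
  open RotorWalk G
  open Unicycles G
  open Periodicity G
  open Exploration G strong
  open RoutingVectors G using (reach⇒routeBy; routeBy-zero)
  open LeastAction G
  open Degree G using (deg-ind)
  open DegreeOne G strong using (debt; reach-unicycle)
  open Transversal using (transversal)

  -- the unicycle reached by the walk from s (kept opaque: only its properties matter)
  opaque
    normal : State → State
    normal s = run (proj₁ (eventually-unicycle s)) s

    normal-unicycle : ∀ s → IsUnicycle (normal s)
    normal-unicycle s = proj₂ (eventually-unicycle s)

    normal-reach : ∀ s → Reach G (LegalStep G) (config s) (config (normal s))
    normal-reach s = run-legal (proj₁ (eventually-unicycle s)) s

  nf : Fin K → State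
  nf x = normal (decode x)

  _~_ : Fin K → Fin K → Set
  x ~ y = OnWalk (nf x) (nf y)

  -- walks from unicycles are cycles, so lying on a common one is a decidable equivalence
  ~-isDecEquivalence : IsDecEquivalence _~_
  ~-isDecEquivalence = record
    { isEquivalence = record
      { refl = 0 , ≃-refl
      ; sym = λ {x} {y} → on-walk-sym (nf x) (normal-unicycle (decode x)) (nf y)
      ; trans = on-walk-trans }
    ; _≟_ = λ x y → on-walk? (nf x) (normal-unicycle (decode x)) (nf y) }

  -- one index per class of _~_ (opaque, so that the search is never unfolded)
  opaque
    classes : Σ ℕ λ m → Σ (Fin m → Fin K) λ e → (∀ i j → e i ~ e j → i ≡ j) × (∀ x → ∃ λ i → e i ~ x)
    classes = transversal ~-isDecEquivalence

    m : ℕ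
    m = proj₁ classes

    chosen : Fin m → Fin K
    chosen = proj₁ (proj₂ classes)

    chosen-distinct : ∀ i j → chosen i ~ chosen j → i ≡ j
    chosen-distinct = proj₁ (proj₂ (proj₂ classes))

    chosen-cover : ∀ x → ∃ λ i → chosen i ~ x
    chosen-cover = proj₂ (proj₂ (proj₂ classes))

  uni : Fin m → State
  uni i = nf (chosen i)

  rep : Fin m → DRC G
  rep i = config (uni i)

  rep-unicycle : ∀ i → IsUnicycle (uni i)
  rep-unicycle i = normal-unicycle (decode (chosen i))

  reaches-rep : ∀ s → ∃ λ i → Reach G (LegalStep G) (config s) (rep i)
  reaches-rep s with chosen-cover (encode s)
  ... | i , i~s with on-walk-sym (uni i) (rep-unicycle i) (nf (encode s)) i~s
  ... | k , s↝i = i , reach-respˡ legal-respˡ (config-cong (decode-encode s))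
        (reach-trans legal-respˡ (normal-reach (decode (encode s)))
        (reach-trans legal-respˡ (run-legal k (nf (encode s))) (done (config-cong s↝i))))

  orbit-returns : ∀ s t → IsUnicycle s → Reach G (LegalStep G) (config s) (config t) → Reach G (LegalStep G) (config t) (config s)
  orbit-returns s t unicycle s↝t with orbit⇒run s↝t s ≋-refl
  ... | k , reached with on-walk-sym s unicycle t (k , config-injective reached)
  ... | k′ , t↝s = reach-trans legal-respˡ (run-legal k′ t) (done (config-cong t↝s))

  rep-distinct : ∀ i j → Reach G (LegalStep G) (rep i) (rep j) → i ≡ j
  rep-distinct i j i↝j with orbit⇒run i↝j (uni i) ≋-refl
  ... | k , reached = chosen-distinct i j (k , config-injective reached)

  unconstrained⇒legal : ∀ i j → Reach G (UnconstrainedStep G) (rep i) (rep j) → Reach G (LegalStep G) (rep i) (rep j)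
  unconstrained⇒legal i j i↝j with reach⇒routeBy i↝j (rep i) (λ _ → 0) (≋-sym (routeBy-zero (rep i)))
  ... | a , j≋ = least-action (uni i) a (uni j) (≋-sym j≋) (rep-unicycle j)

  same-orbit : ∀ {U V} → Reach G (LegalStep G) U V → Reach G (LegalStep G) V U → SameOrbit G U V
  same-orbit U↝V V↝U C = reach-trans legal-respˡ V↝U , reach-trans legal-respˡ U↝V

  degree-classes : NumDeg1Classes G m
  degree-classes = rep , (λ i → deg-ind (chip (uni i))) , distinct , cover
    where
    distinct : ∀ i j → LinEquiv G (rep i) (rep j) → i ≡ j
    distinct i j (inj₁ i↝j) = rep-distinct i j (unconstrained⇒legal i j i↝j)
    distinct i j (inj₂ j↝i) = sym (rep-distinct j i (unconstrained⇒legal j i j↝i))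
    cover : ∀ A → deg G (div A) ≡ + 1 → ∃ λ i → LinEquiv G A (rep i)
    cover A degree with reach-unicycle (debt A) A refl degree
    ... | s , _ , A↝s with reaches-rep s
    ... | i , s↝i = i , inj₁ (reach-trans unconstrained-respˡ A↝s (legal⇒unconstrained s↝i))

  unicycle-orbits : NumUnicycleOrbits G m
  unicycle-orbits = rep , (λ i → unicycle-config (uni i) (rep-unicycle i)) , distinct , cover
    where
    distinct : ∀ i j → SameOrbit G (rep i) (rep j) → i ≡ j
    distinct i j same = rep-distinct i j (proj₂ (same (rep j)) (done ≋-refl))
    cover : ∀ U → Unicycle G U → ∃ λ i → SameOrbit G U (rep i)
    cover U unicycle with unicycle-state U unicycle
    ... | v , U≋ , is-unicycle with reaches-rep (state v (rot U))
    ... | i , s↝i = i , same-orbit (reach-respˡ legal-respˡ (≋-sym U≋) s↝i)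
                      (reach-trans legal-respˡ (orbit-returns _ (uni i) is-unicycle s↝i) (done (≋-sym U≋)))

corollary3p12 : (G : RibbonDigraph) → StronglyConnected G →
    Σ ℕ λ k → NumDeg1Classes G k × NumUnicycleOrbits G k
corollary3p12 G strong = m , degree-classes , unicycle-orbits
  where open Counting G strong
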